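{- Let $(D,X)$ be a dessin d'enfant with edge set $\mathcal E$ and monodromy pair $(\sigma_\circ,\sigma_\bullet)$, let $a,b\in\mathcal E$ be distinct and $t$ the transposition exchanging them. If $z(\sigma_\circ^t\sigma_\bullet)<z(\sigma_\circ\sigma_\bullet)$ then $(\sigma_\circ^t,\sigma_\bullet)$ is transitive.
   Context: Permutations compose functionally, $\pi^s=s\pi s^{ -1}$, $z(\pi)$ is the number of $\pi$-orbits (fixed points included), and a pair is transitive iff the subgroup it generates acts transitively. A dessin d'enfant is a finite bicolored graph $D$ (each vertex white or black, every vertex incident to an edge, every edge joins a white and a black vertex; multiple edges allowed) embedded in a connected oriented compact surface $X$ without boundary so that $X\setminus D$ is a disjoint union of open discs. Its monodromy pair: $\sigma_\circ$ (resp. $\sigma_\bullet$) sends each edge to the next edge around its white (resp. black) vertex in the cyclic order given by the orientation of $X$. -}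

module Defs where

open import Data.Nat using (ℕ; zero; suc; _<_)
open import Data.Fin using (Fin; toℕ)
open import Data.Fin.Permutation using (Permutation′; _⟨$⟩ʳ_; _∘ₚ_; flip; transpose)
open import Data.List using (List; filter; length; allFin; upTo)
open import Data.List.Relation.Unary.All using (All; all?)
open import Data.Nat using (_≤_; _≤?_)
open import Relation.Binary.PropositionalEquality using (_≡_)

-- Functional composition: (σ · τ) x = σ (τ x)
_·_ : ∀ {n} → Permutation′ n → Permutation′ n → Permutation′ n
σ · τ = τ ∘ₚ σ

_^_ : ∀ {n} → Permutation′ n → Permutation′ n → Permutation′ n
π ^ s = s · (π · flip s)

iter : ∀ {n} → Permutation′ n → ℕ → Fin n → Fin n
iter π zero    x = x
iter π (suc k) x = π ⟨$⟩ʳ iter π k x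

-- x is the (toℕ-)least element of its π-orbit.  For a permutation of an
-- n-element set the orbit of x is exactly { π^k x | k < n }.
IsOrbitMin : ∀ {n} → Permutation′ n → Fin n → Set
IsOrbitMin {n} π x = All (λ k → toℕ x ≤ toℕ (iter π k x)) (upTo n)

-- z(π): number of π-orbits (fixed points included), counted via one
-- representative (the least element) per orbit.
z : ∀ {n} → Permutation′ n → ℕ
z {n} π = length (filter (λ x → all? (λ k → toℕ x ≤? toℕ (iter π k x)) (upTo n)) (allFin n))

data Reach {n} (σ τ : Permutation′ n) : Fin n → Fin n → Set where
  here  : ∀ {x} → Reach σ τ x x
  stepσ : ∀ {x y} → Reach σ τ (σ ⟨$⟩ʳ x) y → Reach σ τ x y
  stepτ : ∀ {x y} → Reach σ τ (τ ⟨$⟩ʳ x) y → Reach σ τ x y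
  stepσ⁻ : ∀ {x y} → Reach σ τ (flip σ ⟨$⟩ʳ x) y → Reach σ τ x y
  stepτ⁻ : ∀ {x y} → Reach σ τ (flip τ ⟨$⟩ʳ x) y → Reach σ τ x y

TransitivePair : ∀ {n} → Permutation′ n → Permutation′ n → Set
TransitivePair {n} σ τ = ∀ (x y : Fin n) → Reach σ τ x y

-- Monodromy pair of a dessin d'enfant with n edges (labelled by Fin n):
-- by the Grothendieck correspondence these are exactly the transitive pairs.
record Dessin (n : ℕ) : Set where
  field
    σ∘ σ• : Permutation′ n
    transitive : TransitivePair σ∘ σ•

module Submission where

open import Defs
open import Data.Nat using (ℕ; _<_)
open import Data.Fin using (Fin)
open import Data.Fin.Permutation using (transpose)
open import Relation.Binary.PropositionalEquality using (_≢_)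

open import Data.Fin using (toℕ; zero; suc; _≟_)
open import Data.Fin.Permutation using (Permutation′; _⟨$⟩ʳ_; _⟨$⟩ˡ_; inverseˡ; inverseʳ; _≈_)
open import Data.Fin.Properties using (toℕ-injective; toℕ<n; pigeonhole; suc-injective; 0≢1+n)
open import Data.List using ([]; _∷_; filter; length; allFin; upTo; tabulate)
open import Data.List.Membership.Propositional using (_∈_)
open import Data.List.Membership.Propositional.Properties using (∈-upTo⁺; ∈-upTo⁻; ∈-allFin)
open import Data.List.Properties using (filter-none)
open import Data.List.Relation.Unary.All as All using (All)
open import Data.List.Relation.Unary.All.Properties using (tabulate⁺)
open import Data.List.Relation.Unary.Any using (here; there)
open import Data.Nat using (zero; suc; _+_; _*_; _∸_; _≤_; _≤?_; _<?_; z≤n; s≤s; s≤s⁻¹)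
open import Data.Nat.DivMod using (_%_; _/_; m≡m%n+[m/n]*n; m%n<n)
open import Data.Nat.Induction using (<-wellFounded)
open import Data.Nat.Properties
  using (module ≤-Reasoning; ≤-trans; ≤-antisym; ≤-total; ≤-reflexive; <⇒≱; ≮⇒≥; <-≤-trans;
         m≤n⇒m≤1+n; m<n⇒m<1+n; n≤1+n; n<1+n; m≤n+m; +-suc; +-monoˡ-≤; +-monoʳ-≤; +-comm; *-suc;
         m+[n∸m]≡n; anyUpTo?)
open import Data.Product using (∃; _×_; _,_)
import Data.Product as Product
open import Data.Sum using (_⊎_; inj₁; inj₂; [_,_])
import Data.Sum as Sum
open import Function using (id; _∘_)
open import Induction.WellFounded using (Acc; acc)
open import Level using (0ℓ)
open import Relation.Binary.PropositionalEquality
  using (_≡_; refl; sym; trans; cong; subst; module ≡-Reasoning)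
open import Relation.Nullary using (¬_; Dec; yes; no; contradiction)
open import Relation.Nullary.Decidable using (dec-true; dec-false; map′; _⊎-dec_)
open import Relation.Unary using (Pred; Decidable)

-- Write ρ = σ∘ σ•, ρ′ = σ∘ᵗ σ•, c = σ•⁻¹ a and d = σ•⁻¹ b, so that ρ′ (c d) = t ρ.
-- If c and d lie in one ρ′-orbit, a path from c to d is a word in σ∘ᵗ and σ• taking a to b;
-- then t, and with it σ∘ = t σ∘ᵗ t, moves points only within ⟨σ∘ᵗ, σ•⟩-orbits, so the
-- transitivity of ⟨σ∘, σ•⟩ carries over.  Otherwise right multiplication by (c d) merges two
-- ρ′-orbits, while multiplication by a transposition adds at most one orbit, whence
-- z(ρ) ≤ z(t ρ) + 1 = z(ρ′ (c d)) + 1 = z(ρ′), against the hypothesis.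

module _ {A : Set} {P Q : Pred A 0ℓ} (P? : Decidable P) (Q? : Decidable Q) where

  length-filter-mono : (∀ {x} → P x → Q x) → ∀ xs → length (filter P? xs) ≤ length (filter Q? xs)
  length-filter-mono P⇒Q []       = z≤n
  length-filter-mono P⇒Q (x ∷ xs) with P? x | Q? x
  ... | yes _  | yes _  = s≤s (length-filter-mono P⇒Q xs)
  ... | yes px | no ¬qx = contradiction (P⇒Q px) ¬qx
  ... | no _   | yes _  = m≤n⇒m≤1+n (length-filter-mono P⇒Q xs)
  ... | no _   | no _   = length-filter-mono P⇒Q xs

  length-filter-⊎ : ∀ xs → length (filter (λ x → P? x ⊎-dec Q? x) xs)
                             ≤ length (filter P? xs) + length (filter Q? xs)
  length-filter-⊎ []       = z≤n
  length-filter-⊎ (x ∷ xs) with P? x | Q? x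
  ... | yes _ | yes _ = s≤s (≤-trans (length-filter-⊎ xs) (+-monoʳ-≤ (length (filter P? xs)) (n≤1+n _)))
  ... | yes _ | no _  = s≤s (length-filter-⊎ xs)
  ... | no _  | yes _ = ≤-trans (s≤s (length-filter-⊎ xs)) (≤-reflexive (sym (+-suc _ _)))
  ... | no _  | no _  = length-filter-⊎ xs

length-filter-< : {A : Set} {P Q : Pred A 0ℓ} (P? : Decidable P) (Q? : Decidable Q) →
                  (∀ {x} → Q x → P x) → ∀ {m xs} → m ∈ xs → P m → ¬ Q m →
                  length (filter Q? xs) < length (filter P? xs)
length-filter-< P? Q? Q⇒P {xs = x ∷ xs} (here refl) pm ¬qm with P? x | Q? x
... | yes _  | yes qm = contradiction qm ¬qm
... | yes _  | no _   = s≤s (length-filter-mono Q? P? Q⇒P xs)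
... | no ¬pm | _      = contradiction pm ¬pm
length-filter-< P? Q? Q⇒P {xs = x ∷ xs} (there m∈xs) pm ¬qm with P? x | Q? x
... | yes _  | yes _  = s≤s (length-filter-< P? Q? Q⇒P m∈xs pm ¬qm)
... | yes _  | no _   = m<n⇒m<1+n (length-filter-< P? Q? Q⇒P m∈xs pm ¬qm)
... | no ¬px | yes qx = contradiction (Q⇒P qx) ¬px
... | no _   | no _   = length-filter-< P? Q? Q⇒P m∈xs pm ¬qm

length-filter-≟-tabulate-≤1 : ∀ {k n} (f : Fin k → Fin n) → (∀ {i j} → f i ≡ f j → i ≡ j) →
                              ∀ m → length (filter (_≟ m) (tabulate f)) ≤ 1
length-filter-≟-tabulate-≤1 {zero}  f f-inj m = z≤n
length-filter-≟-tabulate-≤1 {suc k} f f-inj m with f zero ≟ m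
... | yes refl = s≤s (≤-reflexive (cong length (filter-none (_≟ f zero) misses-f₀)))
  where
  misses-f₀ : All (_≢ f zero) (tabulate (f ∘ suc))
  misses-f₀ = tabulate⁺ {f = f ∘ suc} (λ _ → 0≢1+n ∘ f-inj ∘ sym)
... | no _     = length-filter-≟-tabulate-≤1 (f ∘ suc) (suc-injective ∘ f-inj) m

module _ {n : ℕ} where

  transpose-matchˡ : (i j : Fin n) → transpose i j ⟨$⟩ʳ i ≡ j
  transpose-matchˡ i j rewrite dec-true (i ≟ i) refl = refl

  transpose-matchʳ : (i j : Fin n) → transpose i j ⟨$⟩ʳ j ≡ i
  transpose-matchʳ i j with j ≟ i
  ... | yes j≡i = j≡i
  ... | no _ rewrite dec-true (j ≟ j) refl = refl

  transpose-other : ∀ {i j k : Fin n} → k ≢ i → k ≢ j → transpose i j ⟨$⟩ʳ k ≡ k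
  transpose-other {i} {j} {k} k≢i k≢j rewrite dec-false (k ≟ i) k≢i | dec-false (k ≟ j) k≢j = refl

  data Position (i j k : Fin n) : Set where
    at-i  : k ≡ i → Position i j k
    at-j  : k ≡ j → Position i j k
    apart : k ≢ i → k ≢ j → Position i j k

  position : (i j k : Fin n) → Position i j k
  position i j k with k ≟ i | k ≟ j
  ... | yes k≡i | _       = at-i k≡i
  ... | no _    | yes k≡j = at-j k≡j
  ... | no k≢i  | no k≢j  = apart k≢i k≢j

  transpose-involutive : (i j k : Fin n) → transpose i j ⟨$⟩ʳ (transpose i j ⟨$⟩ʳ k) ≡ k
  transpose-involutive i j k with position i j k
  ... | at-i refl     = trans (cong (transpose k j ⟨$⟩ʳ_) (transpose-matchˡ k j)) (transpose-matchʳ k j)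
  ... | at-j refl     = trans (cong (transpose i k ⟨$⟩ʳ_) (transpose-matchʳ i k)) (transpose-matchˡ i k)
  ... | apart k≢i k≢j =
        trans (cong (transpose i j ⟨$⟩ʳ_) (transpose-other k≢i k≢j)) (transpose-other k≢i k≢j)

  transpose-conjugate : (g : Permutation′ n) (a b : Fin n) →
                        g · transpose (g ⟨$⟩ˡ a) (g ⟨$⟩ˡ b) ≈ transpose a b · g
  transpose-conjugate g a b w with position (g ⟨$⟩ˡ a) (g ⟨$⟩ˡ b) w
  ... | at-i refl rewrite transpose-matchˡ (g ⟨$⟩ˡ a) (g ⟨$⟩ˡ b) | inverseʳ g {a} | inverseʳ g {b}
                        | transpose-matchˡ a b = refl
  ... | at-j refl rewrite transpose-matchʳ (g ⟨$⟩ˡ a) (g ⟨$⟩ˡ b) | inverseʳ g {a} | inverseʳ g {b}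
                        | transpose-matchʳ a b = refl
  ... | apart w≢a w≢b rewrite transpose-other w≢a w≢b =
        sym (transpose-other (w≢a ∘ moved) (w≢b ∘ moved))
    where
    moved : ∀ {c} → g ⟨$⟩ʳ w ≡ c → w ≡ g ⟨$⟩ˡ c
    moved refl = sym (inverseˡ g)

  iter-+ : (π : Permutation′ n) (j k : ℕ) (x : Fin n) → iter π (j + k) x ≡ iter π j (iter π k x)
  iter-+ π zero    k x = refl
  iter-+ π (suc j) k x = cong (π ⟨$⟩ʳ_) (iter-+ π j k x)

  iter-injective : (π : Permutation′ n) (k : ℕ) {x y : Fin n} → iter π k x ≡ iter π k y → x ≡ y
  iter-injective π zero    eq = eq
  iter-injective π (suc k) eq =
    iter-injective π k (trans (sym (inverseˡ π)) (trans (cong (π ⟨$⟩ˡ_) eq) (inverseˡ π)))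

  iter-cong : {π ρ : Permutation′ n} → π ≈ ρ → ∀ k x → iter π k x ≡ iter ρ k x
  iter-cong     π≈ρ zero    x = refl
  iter-cong {π} π≈ρ (suc k) x = trans (cong (π ⟨$⟩ʳ_) (iter-cong π≈ρ k x)) (π≈ρ _)

  iter-period : (π : Permutation′ n) (x : Fin n) → ∃ λ q → suc q ≤ n × iter π (suc q) x ≡ x
  iter-period π x with pigeonhole (n<1+n n) (λ i → iter π (toℕ i) x)
  ... | i , j , i<j , eq = q , p≤n , iter-injective π (toℕ i) (begin
        iter π (toℕ i) (iter π (suc q) x) ≡⟨ sym (iter-+ π (toℕ i) (suc q) x) ⟩
        iter π (toℕ i + suc q) x          ≡⟨ cong (λ k → iter π k x) i+p≡j ⟩
        iter π (toℕ j) x                  ≡⟨ sym eq ⟩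
        iter π (toℕ i) x                  ∎)
    where
    open ≡-Reasoning
    q : ℕ
    q = toℕ j ∸ suc (toℕ i)
    i+p≡j : toℕ i + suc q ≡ toℕ j
    i+p≡j = trans (+-suc (toℕ i) q) (m+[n∸m]≡n i<j)
    p≤n : suc q ≤ n
    p≤n = ≤-trans (m≤n+m (suc q) (toℕ i)) (≤-trans (≤-reflexive i+p≡j) (s≤s⁻¹ (toℕ<n j)))

  iter-*-period : (π : Permutation′ n) {x : Fin n} {p : ℕ} → iter π p x ≡ x → ∀ m → iter π (m * p) x ≡ x
  iter-*-period π         period zero    = refl
  iter-*-period π {x} {p} period (suc m) =
    trans (iter-+ π p (m * p) x) (trans (cong (iter π p) (iter-*-period π period m)) period)

  iter-mod : (π : Permutation′ n) (x : Fin n) (k : ℕ) → ∃ λ r → r < n × iter π k x ≡ iter π r x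
  iter-mod π x k with iter-period π x
  ... | q , p≤n , period = k % p , <-≤-trans (m%n<n k p) p≤n , (begin
        iter π k x                              ≡⟨ cong (λ m → iter π m x) (m≡m%n+[m/n]*n k p) ⟩
        iter π (k % p + k / p * p) x            ≡⟨ iter-+ π (k % p) _ x ⟩
        iter π (k % p) (iter π (k / p * p) x)   ≡⟨ cong (iter π (k % p)) (iter-*-period π period (k / p)) ⟩
        iter π (k % p) x                        ∎)
    where
    open ≡-Reasoning
    p : ℕ
    p = suc q

  SameOrbit : Permutation′ n → Fin n → Fin n → Set
  SameOrbit π x y = ∃ λ k → iter π k x ≡ y

  ≡⇒sameOrbit : {π : Permutation′ n} {x y : Fin n} → x ≡ y → SameOrbit π x y
  ≡⇒sameOrbit x≡y = 0 , x≡y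

  sameOrbit-step : {π : Permutation′ n} {x : Fin n} → SameOrbit π x (π ⟨$⟩ʳ x)
  sameOrbit-step = 1 , refl

  sameOrbit-trans : {π : Permutation′ n} {x y w : Fin n} →
                    SameOrbit π x y → SameOrbit π y w → SameOrbit π x w
  sameOrbit-trans {π} {x} (j , refl) (k , refl) = k + j , iter-+ π k j x

  sameOrbit-sym : {π : Permutation′ n} {x y : Fin n} → SameOrbit π x y → SameOrbit π y x
  sameOrbit-sym {π} {x} (k , refl) with iter-period π x
  ... | q , _ , period = k * q , (begin
        iter π (k * q) (iter π k x) ≡⟨ sym (iter-+ π (k * q) k x) ⟩
        iter π (k * q + k) x        ≡⟨ cong (λ m → iter π m x) (trans (+-comm (k * q) k) (sym (*-suc k q))) ⟩
        iter π (k * suc q) x        ≡⟨ iter-*-period π period k ⟩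
        x                           ∎)
    where open ≡-Reasoning

  sameOrbit-cong : {π ρ : Permutation′ n} → π ≈ ρ → ∀ {x y} → SameOrbit π x y → SameOrbit ρ x y
  sameOrbit-cong π≈ρ {x} (k , eq) = k , trans (sym (iter-cong π≈ρ k x)) eq

  sameOrbit? : (π : Permutation′ n) (x y : Fin n) → Dec (SameOrbit π x y)
  sameOrbit? π x y = map′ (λ (k , _ , eq) → k , eq) within-n (anyUpTo? (λ k → iter π k x ≟ y) n)
    where
    within-n : SameOrbit π x y → ∃ λ r → r < n × iter π r x ≡ y
    within-n (k , eq) with iter-mod π x k
    ... | r , r<n , eq′ = r , r<n , trans (sym eq′) eq

  sameOrbit-ind : (π : Permutation′ n) (R : Fin n → Fin n → Set) → (∀ {w} → R w w) →
                  (∀ {u v w} → R u v → R v w → R u w) → (∀ w → R w (π ⟨$⟩ʳ w)) →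
                  ∀ {x y} → SameOrbit π x y → R x y
  sameOrbit-ind π R refl′ trans′ step {x} (k , refl) = go k
    where
    go : ∀ k → R x (iter π k x)
    go zero    = refl′
    go (suc k) = trans′ (go k) (step _)

  IsLeastInOrbit : Permutation′ n → Fin n → Set
  IsLeastInOrbit π x = ∀ {y} → SameOrbit π x y → toℕ x ≤ toℕ y

  isOrbitMin⇒isLeastInOrbit : {π : Permutation′ n} {x : Fin n} → IsOrbitMin π x → IsLeastInOrbit π x
  isOrbitMin⇒isLeastInOrbit {π} {x} min (k , refl) with iter-mod π x k
  ... | r , r<n , eq rewrite eq = All.lookup min (∈-upTo⁺ r<n)

  isLeastInOrbit⇒isOrbitMin : {π : Permutation′ n} {x : Fin n} → IsLeastInOrbit π x → IsOrbitMin π x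
  isLeastInOrbit⇒isOrbitMin least = All.tabulate (λ {k} _ → least (k , refl))

  isLeastInOrbit-cong : {π ρ : Permutation′ n} → π ≈ ρ → ∀ {x} → IsLeastInOrbit π x → IsLeastInOrbit ρ x
  isLeastInOrbit-cong π≈ρ least = least ∘ sameOrbit-cong (sym ∘ π≈ρ)

  leastInOrbit : (π : Permutation′ n) (x : Fin n) → ∃ λ m → SameOrbit π x m × IsLeastInOrbit π m
  leastInOrbit π x = go x (<-wellFounded (toℕ x))
    where
    go : ∀ x → Acc _<_ (toℕ x) → ∃ λ m → SameOrbit π x m × IsLeastInOrbit π m
    go x (acc smaller) with anyUpTo? (λ k → toℕ (iter π k x) <? toℕ x) n
    ... | yes (k , _ , lt) with go (iter π k x) (smaller lt)
    ...   | m , y~m , least = m , sameOrbit-trans (k , refl) y~m , least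
    go x (acc smaller) | no none = x , ≡⇒sameOrbit refl , isOrbitMin⇒isLeastInOrbit
      (All.tabulate λ k∈ → ≮⇒≥ (λ lt → none (_ , ∈-upTo⁻ k∈ , lt)))

  private
    isOrbitMin? : (π : Permutation′ n) → Decidable (IsOrbitMin π)
    isOrbitMin? π x = All.all? (λ k → toℕ x ≤? toℕ (iter π k x)) (upTo n)

  z-mono : {π ρ : Permutation′ n} → (∀ {x} → IsLeastInOrbit π x → IsLeastInOrbit ρ x) → z π ≤ z ρ
  z-mono {π} {ρ} π⇒ρ = length-filter-mono (isOrbitMin? π) (isOrbitMin? ρ)
    (isLeastInOrbit⇒isOrbitMin ∘ π⇒ρ ∘ isOrbitMin⇒isLeastInOrbit) (allFin n)

  z-cong : {π ρ : Permutation′ n} → π ≈ ρ → z π ≡ z ρ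
  z-cong π≈ρ = ≤-antisym (z-mono (isLeastInOrbit-cong π≈ρ)) (z-mono (isLeastInOrbit-cong (sym ∘ π≈ρ)))

  z-< : {π ρ : Permutation′ n} {m : Fin n} → (∀ {x} → IsLeastInOrbit ρ x → IsLeastInOrbit π x) →
        IsLeastInOrbit π m → ¬ IsLeastInOrbit ρ m → z ρ < z π
  z-< {π} {ρ} {m} ρ⇒π π-least ¬ρ-least = length-filter-< (isOrbitMin? π) (isOrbitMin? ρ)
    (isLeastInOrbit⇒isOrbitMin ∘ ρ⇒π ∘ isOrbitMin⇒isLeastInOrbit) (∈-allFin m)
    (isLeastInOrbit⇒isOrbitMin π-least) (¬ρ-least ∘ isOrbitMin⇒isLeastInOrbit)

  z-≤-suc : {π ρ : Permutation′ n} {m : Fin n} →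
            (∀ {x} → IsLeastInOrbit π x → x ≢ m → IsLeastInOrbit ρ x) → z π ≤ suc (z ρ)
  z-≤-suc {π} {ρ} {m} π⇒ρ = begin
    z π                                     ≤⟨ length-filter-mono (isOrbitMin? π) m-or-ρ? m-or-ρ (allFin n) ⟩
    length (filter m-or-ρ? (allFin n))      ≤⟨ length-filter-⊎ (_≟ m) (isOrbitMin? ρ) (allFin n) ⟩
    length (filter (_≟ m) (allFin n)) + z ρ ≤⟨ +-monoˡ-≤ (z ρ) (length-filter-≟-tabulate-≤1 id id m) ⟩
    suc (z ρ)                               ∎
    where
    open ≤-Reasoning
    m-or-ρ? : Decidable (λ x → x ≡ m ⊎ IsOrbitMin ρ x)
    m-or-ρ? x = (x ≟ m) ⊎-dec isOrbitMin? ρ x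
    m-or-ρ : ∀ {x} → IsOrbitMin π x → x ≡ m ⊎ IsOrbitMin ρ x
    m-or-ρ {x} min with x ≟ m
    ... | yes x≡m = inj₁ x≡m
    ... | no x≢m  = inj₂ (isLeastInOrbit⇒isOrbitMin (π⇒ρ (isOrbitMin⇒isLeastInOrbit min) x≢m))

  z-<-join : {π ρ : Permutation′ n} {m₁ m₂ : Fin n} → (∀ {x} → IsLeastInOrbit ρ x → IsLeastInOrbit π x) →
             IsLeastInOrbit π m₁ → IsLeastInOrbit π m₂ → m₁ ≢ m₂ → SameOrbit ρ m₁ m₂ → z ρ < z π
  z-<-join {m₁ = m₁} {m₂} ρ⇒π least₁ least₂ m₁≢m₂ m₁~m₂ with ≤-total (toℕ m₁) (toℕ m₂)
  ... | inj₁ m₁≤m₂ = z-< ρ⇒π least₂ λ least₂′ →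
        m₁≢m₂ (toℕ-injective (≤-antisym m₁≤m₂ (least₂′ (sameOrbit-sym m₁~m₂))))
  ... | inj₂ m₂≤m₁ = z-< ρ⇒π least₁ λ least₁′ →
        m₁≢m₂ (toℕ-injective (≤-antisym (least₁′ m₁~m₂) m₂≤m₁))

  InEitherOrbit : Permutation′ n → Fin n → Fin n → Fin n → Set
  InEitherOrbit π c d u = SameOrbit π u c ⊎ SameOrbit π u d

  Glued : Permutation′ n → Fin n → Fin n → Fin n → Fin n → Set
  Glued π c d x y = SameOrbit π x y ⊎ (InEitherOrbit π c d x × InEitherOrbit π c d y)

  module _ {π : Permutation′ n} {c d : Fin n} where

    inEitherOrbit-pre : ∀ {u v} → SameOrbit π u v → InEitherOrbit π c d v → InEitherOrbit π c d u
    inEitherOrbit-pre u~v = Sum.map (sameOrbit-trans u~v) (sameOrbit-trans u~v)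

    glued-trans : ∀ {u v w} → Glued π c d u v → Glued π c d v w → Glued π c d u w
    glued-trans (inj₁ u~v)       (inj₁ v~w)       = inj₁ (sameOrbit-trans u~v v~w)
    glued-trans (inj₁ u~v)       (inj₂ (v∈ , w∈)) = inj₂ (inEitherOrbit-pre u~v v∈ , w∈)
    glued-trans (inj₂ (u∈ , v∈)) (inj₁ v~w)       = inj₂ (u∈ , inEitherOrbit-pre (sameOrbit-sym v~w) v∈)
    glued-trans (inj₂ (u∈ , _))  (inj₂ (_ , w∈))  = inj₂ (u∈ , w∈)

    glued-swap : ∀ {u v} → Glued π c d u v → Glued π d c u v
    glued-swap = Sum.map₂ (Product.map Sum.swap Sum.swap)

    glued-move : ∀ {c′ d′ u v} → SameOrbit π c c′ → SameOrbit π d d′ → Glued π c d u v → Glued π c′ d′ u v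
    glued-move c~c′ d~d′ = Sum.map₂ (Product.map move move)
      where
      move : ∀ {u} → InEitherOrbit π c d u → InEitherOrbit π _ _ u
      move = Sum.map (λ u~c → sameOrbit-trans u~c c~c′) (λ u~d → sameOrbit-trans u~d d~d′)

  z-≤-glued-least : {α β : Permutation′ n} {m₁ m₂ : Fin n} →
                    IsLeastInOrbit α m₁ → IsLeastInOrbit α m₂ → toℕ m₁ ≤ toℕ m₂ →
                    (∀ {x y} → SameOrbit β x y → Glued α m₁ m₂ x y) → z α ≤ suc (z β)
  z-≤-glued-least {α} {β} {m₁} {m₂} least₁ least₂ m₁≤m₂ β⊆glued = z-≤-suc stays-least
    where
    stays-least : ∀ {x} → IsLeastInOrbit α x → x ≢ m₂ → IsLeastInOrbit β x
    stays-least x-least x≢m₂ x~y with β⊆glued x~y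
    ... | inj₁ x~y′                    = x-least x~y′
    ... | inj₂ (inj₂ x~m₂ , _)         =
          contradiction (toℕ-injective (≤-antisym (x-least x~m₂) (least₂ (sameOrbit-sym x~m₂)))) x≢m₂
    ... | inj₂ (inj₁ x~m₁ , inj₁ y~m₁) = x-least (sameOrbit-trans x~m₁ (sameOrbit-sym y~m₁))
    ... | inj₂ (inj₁ x~m₁ , inj₂ y~m₂) = ≤-trans (x-least x~m₁) (≤-trans m₁≤m₂ (least₂ (sameOrbit-sym y~m₂)))

  z-≤-glued : {α β : Permutation′ n} {c d : Fin n} →
              (∀ {x y} → SameOrbit β x y → Glued α c d x y) → z α ≤ suc (z β)
  z-≤-glued {α} {β} {c} {d} β⊆glued with leastInOrbit α c | leastInOrbit α d
  ... | mc , c~mc , mc-least | md , d~md , md-least with ≤-total (toℕ mc) (toℕ md)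
  ... | inj₁ mc≤md = z-≤-glued-least mc-least md-least mc≤md (glued-move c~mc d~md ∘ β⊆glued)
  ... | inj₂ md≤mc = z-≤-glued-least md-least mc-least md≤mc (glued-swap ∘ glued-move c~mc d~md ∘ β⊆glued)

  module _ {π : Permutation′ n} {c d : Fin n} where

    sameOrbit-·-transpose : SameOrbit (π · transpose c d) c d →
                            ∀ {x y} → SameOrbit π x y → SameOrbit (π · transpose c d) x y
    sameOrbit-·-transpose c~d =
      sameOrbit-ind π (SameOrbit (π · transpose c d)) (≡⇒sameOrbit refl) sameOrbit-trans step
      where
      step : ∀ w → SameOrbit (π · transpose c d) w (π ⟨$⟩ʳ w)
      step w with position c d w
      ... | at-i refl     = sameOrbit-trans c~d (1 , cong (π ⟨$⟩ʳ_) (transpose-matchʳ c d))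
      ... | at-j refl     = sameOrbit-trans (sameOrbit-sym c~d) (1 , cong (π ⟨$⟩ʳ_) (transpose-matchˡ c d))
      ... | apart w≢c w≢d = 1 , cong (π ⟨$⟩ʳ_) (transpose-other w≢c w≢d)

    -- Starting from (π · (c d)) c = π d, follow the π-orbit of d back to d: it avoids c, and
    -- π · (c d) agrees with π off {c, d}.
    ·-transpose-joins : ¬ SameOrbit π c d → SameOrbit (π · transpose c d) c d
    ·-transpose-joins c≁d with iter-period π d
    ... | q , _ , period = [ id , subst (SameOrbit (π · transpose c d) c) period ] (walk q)
      where
      walk : ∀ j → SameOrbit (π · transpose c d) c d ⊎ SameOrbit (π · transpose c d) c (iter π (suc j) d)
      walk zero = inj₂ (1 , cong (π ⟨$⟩ʳ_) (transpose-matchˡ c d))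
      walk (suc j) with walk j
      ... | inj₁ c~d = inj₁ c~d
      ... | inj₂ c~u with iter π (suc j) d ≟ d
      ...   | yes u≡d = inj₁ (subst (SameOrbit (π · transpose c d) c) u≡d c~u)
      ...   | no u≢d  = inj₂ (sameOrbit-trans c~u (1 , cong (π ⟨$⟩ʳ_) (transpose-other u≢c u≢d)))
        where
        u≢c : iter π (suc j) d ≢ c
        u≢c u≡c = c≁d (sameOrbit-sym (suc j , u≡c))

    sameOrbit-·-transpose⇒glued : ∀ {x y} → SameOrbit (π · transpose c d) x y → Glued π c d x y
    sameOrbit-·-transpose⇒glued =
      sameOrbit-ind (π · transpose c d) (Glued π c d) (inj₁ (≡⇒sameOrbit refl)) glued-trans step
      where
      back-to : ∀ {u v} → u ≡ v → SameOrbit π (π ⟨$⟩ʳ u) v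
      back-to refl = sameOrbit-sym sameOrbit-step
      step : ∀ w → Glued π c d w (π ⟨$⟩ʳ (transpose c d ⟨$⟩ʳ w))
      step w with position c d w
      ... | at-i refl     = inj₂ (inj₁ (≡⇒sameOrbit refl) , inj₂ (back-to (transpose-matchˡ c d)))
      ... | at-j refl     = inj₂ (inj₂ (≡⇒sameOrbit refl) , inj₁ (back-to (transpose-matchʳ c d)))
      ... | apart w≢c w≢d = inj₁ (1 , cong (π ⟨$⟩ʳ_) (sym (transpose-other w≢c w≢d)))

  z-·-transpose-< : (π : Permutation′ n) (c d : Fin n) → ¬ SameOrbit π c d → z (π · transpose c d) < z π
  z-·-transpose-< π c d c≁d with leastInOrbit π c | leastInOrbit π d
  ... | mc , c~mc , mc-least | md , d~md , md-least =
        z-<-join (λ least → least ∘ coarser) mc-least md-least mc≢md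
          (sameOrbit-trans (coarser (sameOrbit-sym c~mc)) (sameOrbit-trans (·-transpose-joins c≁d) (coarser d~md)))
    where
    coarser : ∀ {x y} → SameOrbit π x y → SameOrbit (π · transpose c d) x y
    coarser = sameOrbit-·-transpose (·-transpose-joins c≁d)
    mc≢md : mc ≢ md
    mc≢md mc≡md = c≁d (sameOrbit-trans c~mc (subst (λ m → SameOrbit π m d) (sym mc≡md) (sameOrbit-sym d~md)))

  z-·-transpose-≤ : (π : Permutation′ n) (c d : Fin n) → z (π · transpose c d) ≤ suc (z π)
  z-·-transpose-≤ π c d = z-≤-glued (sameOrbit-·-transpose⇒glued ∘ sameOrbit-cong untranspose)
    where
    untranspose : π ≈ (π · transpose c d) · transpose c d
    untranspose w = cong (π ⟨$⟩ʳ_) (sym (transpose-involutive c d w))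

  z-≤-transpose-· : (π : Permutation′ n) (a b : Fin n) → z π ≤ suc (z (transpose a b · π))
  z-≤-transpose-· π a b = subst (_≤ suc (z μ)) (z-cong μ·t≈π) (z-·-transpose-≤ μ (μ ⟨$⟩ˡ a) (μ ⟨$⟩ˡ b))
    where
    μ : Permutation′ n
    μ = transpose a b · π
    μ·t≈π : μ · transpose (μ ⟨$⟩ˡ a) (μ ⟨$⟩ˡ b) ≈ π
    μ·t≈π w = trans (transpose-conjugate μ a b w) (transpose-involutive a b (π ⟨$⟩ʳ w))

  ^-transpose-·-transpose : (σ τ : Permutation′ n) (a b : Fin n) →
                            ((σ ^ transpose a b) · τ) · transpose (τ ⟨$⟩ˡ a) (τ ⟨$⟩ˡ b) ≈ transpose a b · (σ · τ)
  ^-transpose-·-transpose σ τ a b w =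
    trans (cong ((σ ^ transpose a b) ⟨$⟩ʳ_) (transpose-conjugate τ a b w))
          (cong (λ u → transpose a b ⟨$⟩ʳ (σ ⟨$⟩ʳ u)) (inverseˡ (transpose a b)))

  z-≤-^-transpose : (σ τ : Permutation′ n) (a b : Fin n) →
                    ¬ SameOrbit ((σ ^ transpose a b) · τ) (τ ⟨$⟩ˡ a) (τ ⟨$⟩ˡ b) →
                    z (σ · τ) ≤ z ((σ ^ transpose a b) · τ)
  z-≤-^-transpose σ τ a b c≁d = begin
    z (σ · τ)                          ≤⟨ z-≤-transpose-· (σ · τ) a b ⟩
    suc (z (transpose a b · (σ · τ)))  ≡⟨ cong suc (z-cong (sym ∘ ^-transpose-·-transpose σ τ a b)) ⟩
    suc (z (ρ′ · transpose c d))       ≤⟨ z-·-transpose-< ρ′ c d c≁d ⟩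
    z ρ′                               ∎
    where
    open ≤-Reasoning
    ρ′ : Permutation′ n
    ρ′ = (σ ^ transpose a b) · τ
    c d : Fin n
    c = τ ⟨$⟩ˡ a
    d = τ ⟨$⟩ˡ b

  module _ {σ τ : Permutation′ n} where

    reach-trans : ∀ {x y w} → Reach σ τ x y → Reach σ τ y w → Reach σ τ x w
    reach-trans here       q = q
    reach-trans (stepσ p)  q = stepσ (reach-trans p q)
    reach-trans (stepτ p)  q = stepτ (reach-trans p q)
    reach-trans (stepσ⁻ p) q = stepσ⁻ (reach-trans p q)
    reach-trans (stepτ⁻ p) q = stepτ⁻ (reach-trans p q)

    ≡⇒reach : ∀ {x y} → x ≡ y → Reach σ τ x y
    ≡⇒reach refl = here

    reach-sym : ∀ {x y} → Reach σ τ x y → Reach σ τ y x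
    reach-sym here       = here
    reach-sym (stepσ p)  = reach-trans (reach-sym p) (stepσ⁻ (≡⇒reach (inverseˡ σ)))
    reach-sym (stepτ p)  = reach-trans (reach-sym p) (stepτ⁻ (≡⇒reach (inverseˡ τ)))
    reach-sym (stepσ⁻ p) = reach-trans (reach-sym p) (stepσ (≡⇒reach (inverseʳ σ)))
    reach-sym (stepτ⁻ p) = reach-trans (reach-sym p) (stepτ (≡⇒reach (inverseʳ τ)))

    sameOrbit-·⇒reach : ∀ {x y} → SameOrbit (σ · τ) x y → Reach σ τ x y
    sameOrbit-·⇒reach = sameOrbit-ind (σ · τ) (Reach σ τ) here reach-trans (λ _ → stepτ (stepσ here))

    reach-transpose : ∀ {a b} → Reach σ τ a b → ∀ u → Reach σ τ u (transpose a b ⟨$⟩ʳ u)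
    reach-transpose {a} {b} a~b u with position a b u
    ... | at-i refl     = reach-trans a~b (≡⇒reach (sym (transpose-matchˡ u b)))
    ... | at-j refl     = reach-trans (reach-sym a~b) (≡⇒reach (sym (transpose-matchʳ a u)))
    ... | apart u≢a u≢b = ≡⇒reach (sym (transpose-other u≢a u≢b))

  reach-mono : {σ σ′ τ : Permutation′ n} → (∀ w → Reach σ′ τ w (σ ⟨$⟩ʳ w)) →
               ∀ {x y} → Reach σ τ x y → Reach σ′ τ x y
  reach-mono     σ-move here       = here
  reach-mono     σ-move (stepσ p)  = reach-trans (σ-move _) (reach-mono σ-move p)
  reach-mono     σ-move (stepτ p)  = stepτ (reach-mono σ-move p)
  reach-mono {σ} σ-move (stepσ⁻ p) =
    reach-trans (reach-sym (reach-trans (σ-move _) (≡⇒reach (inverseʳ σ)))) (reach-mono σ-move p)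
  reach-mono     σ-move (stepτ⁻ p) = stepτ⁻ (reach-mono σ-move p)

  reach-^-transpose : {σ τ : Permutation′ n} {a b : Fin n} → Reach (σ ^ transpose a b) τ a b →
                      ∀ w → Reach (σ ^ transpose a b) τ w (σ ⟨$⟩ʳ w)
  reach-^-transpose {σ} {a = a} {b} a~b w =
    reach-trans (reach-transpose a~b w) (stepσ (reach-trans
      (≡⇒reach (cong (λ u → t ⟨$⟩ʳ (σ ⟨$⟩ʳ u)) (inverseˡ t)))
      (reach-trans (reach-transpose a~b _) (≡⇒reach (transpose-involutive a b _)))))
    where
    t : Permutation′ n
    t = transpose a b

  transitive-^-transpose : {σ τ : Permutation′ n} (a b : Fin n) → TransitivePair σ τ →
                           z ((σ ^ transpose a b) · τ) < z (σ · τ) → TransitivePair (σ ^ transpose a b) τ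
  transitive-^-transpose {σ} {τ} a b transitive fewer
    with sameOrbit? ((σ ^ transpose a b) · τ) (τ ⟨$⟩ˡ a) (τ ⟨$⟩ˡ b)
  ... | yes c~d = λ x y → reach-mono (reach-^-transpose {σ = σ} a~b) (transitive x y)
    where
    a~b : Reach (σ ^ transpose a b) τ a b
    a~b = stepτ⁻ (reach-trans (sameOrbit-·⇒reach c~d) (stepτ (≡⇒reach (inverseʳ τ))))
  ... | no c≁d = contradiction (z-≤-^-transpose σ τ a b c≁d) (<⇒≱ fewer)

mainTheorem4 : (n : ℕ) (D : Dessin n) (a b : Fin n) → a ≢ b →
    z ((Dessin.σ∘ D ^ transpose a b) · Dessin.σ• D) < z (Dessin.σ∘ D · Dessin.σ• D) →
    TransitivePair (Dessin.σ∘ D ^ transpose a b) (Dessin.σ• D)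
mainTheorem4 n D a b _ = transitive-^-transpose a b (Dessin.transitive D)
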